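{- Let $J_2$ be the graph with vertex set $\{v_1,\dots,v_6\}$ and edge set $\{v_1v_2, v_2v_3, v_3v_4, v_1v_5, v_2v_5, v_3v_6, v_4v_6\}$, and let $L$ be a list assignment on $V(J_2)$. Then $J_2^2$ is $L$-colorable if $L$ satisfies one of the following conditions: (1) $|L(v_1)|=2$, $|L(v_2)|=4$, $|L(v_3)|=4$, $|L(v_4)|=3$, $|L(v_5)|=2$, $|L(v_6)|=2$, and $L(v_1)\neq L(v_5)$; (2) $|L(v_1)|=3$, $|L(v_2)|=4$, $|L(v_3)|=4$, $|L(v_4)|=3$, $|L(v_5)|=2$, $|L(v_6)|=2$.
   Context: The square $H^2$ of a graph $H$ has vertex set $V(H)$ and an edge between any two distinct vertices at distance at most $2$ in $H$. For a list assignment $L$ (assigning a set of colors to each vertex), a graph is $L$-colorable if it admits a proper coloring $f$ with $f(v)\in L(v)$ for every vertex $v$. -}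

module Defs where

open import Data.Nat using (ℕ)
open import Data.Fin using (Fin)
open import Data.Fin.Patterns
open import Data.List using (List; length)
open import Data.List.Membership.Propositional using (_∈_)
open import Data.List.Relation.Unary.Unique.Propositional using (Unique)
open import Data.Product using (Σ; ∃; _×_)
open import Data.Sum using (_⊎_)
open import Relation.Binary.PropositionalEquality using (_≡_; _≢_)
open import Relation.Nullary using (¬_)

Color : Set
Color = ℕ

-- Vertices of J₂: 0F,…,5F stand for v₁,…,v₆.
V : Set
V = Fin 6

data E : V → V → Set where
  e12 : E 0F 1F
  e23 : E 1F 2F
  e34 : E 2F 3F
  e15 : E 0F 4F
  e25 : E 1F 4F
  e36 : E 2F 5F
  e46 : E 3F 5F

Adj : V → V → Set
Adj u v = E u v ⊎ E v u

Adj² : V → V → Set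
Adj² u v = u ≢ v × (Adj u v ⊎ ∃ λ w → Adj u w × Adj w v)

record ListAssignment : Set where
  field
    L      : V → List Color
    unique : ∀ v → Unique (L v)
open ListAssignment public

∣_∣at_ : ListAssignment → V → ℕ
∣ 𝓛 ∣at v = length (L 𝓛 v)

SameSet : List Color → List Color → Set
SameSet A B = ∀ c → (c ∈ A → c ∈ B) × (c ∈ B → c ∈ A)

Square-L-colorable : ListAssignment → Set
Square-L-colorable 𝓛 =
  Σ (V → Color) λ f → (∀ v → f v ∈ L 𝓛 v) × (∀ u v → Adj² u v → f u ≢ f v)

{-# OPTIONS --safe #-}
module Submission where

-- Every two vertices of J₂ are at distance at most 2 except v₁, v₅ versus v₄, v₆, so
-- J₂² is the join of the edge v₂v₃ with the two disjoint edges v₁v₅ and v₄v₆. We need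
-- colours b ∈ L(v₂), c ∈ L(v₃), b ≠ c, such that both outer edges stay colourable from
-- their lists without b and c. Under either hypothesis both outer edges are "good": they
-- can be coloured avoiding any one colour, and each colour x of their lists can be put on
-- one end in two ways, with two distinct partner colours.
-- If the outer edges share no colour, any c ∈ L(v₃) misses the lists of one of them: colour
-- the other edge avoiding c, take b ∈ L(v₂) avoiding c and those two colours, and colour the
-- remaining edge avoiding b. If they share a colour x, put x on both edges; either two
-- partner choices u, w coincide, or x, u₁, u₂, w₁, w₂ are five distinct colours and one of
-- them is missing from L(v₂). Either way the outer colours x, u, w use at most two colours
-- of L(v₂), which leaves room to choose c and then b.

open import Defs
open import Function using (_∘_)
open import Data.Empty using (⊥-elim)
open import Data.Fin.Patterns
open import Data.Nat using (ℕ; suc; _≤_; _<_; z≤n; s≤s; _<?_; _≟_; ∣_-_∣)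
open import Data.Nat.Properties
  using (≤-refl; ≤-trans; ≤-reflexive; <⇒≱; +-mono-≤; ∣-∣-comm; ∣-∣-triangle)
open import Data.List using (List; []; _∷_; length; _++_)
open import Data.List.Properties using (length-++-sucʳ)
open import Data.List.Membership.Propositional using (_∈_; _∉_; find; lose)
open import Data.List.Membership.Propositional.Properties using (∈-++⁺ˡ; ∈-++⁺ʳ; ∈-++⁻; ∈-∃++)
open import Data.List.Membership.DecPropositional _≟_ using (_∈?_)
open import Data.List.Relation.Binary.Subset.Propositional using (_⊆_)
open import Data.List.Relation.Binary.Disjoint.Propositional using (Disjoint)
open import Data.List.Relation.Unary.Any using (here; there; any?)
open import Data.List.Relation.Unary.All as All using (All; []; _∷_; all?)
open import Data.List.Relation.Unary.All.Properties using (¬All⇒Any¬; ¬Any⇒All¬)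
  renaming (++⁺ to All-++⁺)
open import Data.List.Relation.Unary.AllPairs using ([]; _∷_)
open import Data.List.Relation.Unary.Unique.Propositional using (Unique)
open import Data.List.Relation.Unary.Unique.Propositional.Properties using ()
  renaming (++⁺ to Unique-++⁺)
open import Data.Product using (_×_; ∃; ∃₂; _,_)
open import Data.Sum using (_⊎_; inj₁; inj₂; [_,_]; fromInj₁)
open import Relation.Binary.PropositionalEquality
  using (_≡_; _≢_; refl; sym; trans; cong; subst; ≢-sym)
open import Relation.Nullary using (¬_; yes; no; contradiction)
open import Relation.Nullary.Decidable using (True; toWitness)

private
  variable
    s t u w x y : Color
    xs ys m P Q P′ Q′ B C : List Color
    n : ℕ

∉⇒≢ : x ∉ xs → y ∈ xs → x ≢ y
∉⇒≢ x∉xs y∈xs refl = x∉xs y∈xs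

∈-++-∷⁻ : ∀ ws {zs} → y ∈ ws ++ x ∷ zs → y ≢ x → y ∈ ws ++ zs
∈-++-∷⁻ ws y∈ y≢x with ∈-++⁻ ws y∈
... | inj₁ y∈ws         = ∈-++⁺ˡ y∈ws
... | inj₂ (here y≡x)   = contradiction y≡x y≢x
... | inj₂ (there y∈zs) = ∈-++⁺ʳ ws y∈zs

Unique-⊆⇒length≤ : Unique xs → xs ⊆ ys → length xs ≤ length ys
Unique-⊆⇒length≤ [] _ = z≤n
Unique-⊆⇒length≤ {x ∷ xs} (x≢xs ∷ u) x∷xs⊆ys with ∈-∃++ (x∷xs⊆ys (here refl))
... | ws , zs , refl =
  ≤-trans (s≤s (Unique-⊆⇒length≤ u xs⊆ws++zs)) (≤-reflexive (sym (length-++-sucʳ ws x zs)))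
  where
  xs⊆ws++zs : xs ⊆ ws ++ zs
  xs⊆ws++zs y∈xs = ∈-++-∷⁻ ws (x∷xs⊆ys (there y∈xs)) (≢-sym (All.lookup x≢xs y∈xs))

Unique-length<⇒⊈ : Unique ys → length xs < length ys → ¬ ys ⊆ xs
Unique-length<⇒⊈ u xs<ys ys⊆xs = <⇒≱ xs<ys (Unique-⊆⇒length≤ u ys⊆xs)

⊆-or-∉ : (xs ys : List Color) → xs ⊆ ys ⊎ ∃ λ x → x ∈ xs × x ∉ ys
⊆-or-∉ xs ys with all? (_∈? ys) xs
... | yes all∈ = inj₁ (All.lookup all∈)
... | no ¬all∈ = inj₂ (find (¬All⇒Any¬ (_∈? ys) xs ¬all∈))

∉-witness : Unique xs → length ys < length xs → ∃ λ x → x ∈ xs × x ∉ ys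
∉-witness {xs} {ys} u ys<xs with ⊆-or-∉ xs ys
... | inj₁ xs⊆ys = ⊥-elim (Unique-length<⇒⊈ u ys<xs xs⊆ys)
... | inj₂ x∉    = x∉

Unique-∷-++⁺ : Unique (x ∷ xs) → Unique (x ∷ ys) → Disjoint xs ys → Unique (x ∷ xs ++ ys)
Unique-∷-++⁺ (x∉xs ∷ uxs) (x∉ys ∷ uys) xs#ys = All-++⁺ x∉xs x∉ys ∷ Unique-++⁺ uxs uys xs#ys

Avoiding : List Color → Color → Set
Avoiding ys x = All (x ≢_) ys

fresh : Unique xs → length xs ≡ n → (ys : List Color) → {True (length ys <? n)} →
        ∃ λ x → x ∈ xs × Avoiding ys x
fresh u refl ys {ys<n} with ∉-witness u (toWitness ys<n)
... | x , x∈xs , x∉ys = x , x∈xs , ¬Any⇒All¬ ys x∉ys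

pair-⊆ : Unique xs → length xs ≡ 2 → x ∈ xs → y ∈ xs → x ≢ y → xs ⊆ x ∷ y ∷ []
pair-⊆ {xs} {x} {y} u l x∈xs y∈xs x≢y with ⊆-or-∉ xs (x ∷ y ∷ [])
... | inj₁ xs⊆xy = xs⊆xy
... | inj₂ (z , z∈xs , z∉xy) with ¬Any⇒All¬ (x ∷ y ∷ []) z∉xy
...   | z≢x ∷ z≢y ∷ [] =
  ⊥-elim (Unique-length<⇒⊈ ((x≢y ∷ ≢-sym z≢x ∷ []) ∷ (≢-sym z≢y ∷ []) ∷ [] ∷ [])
                           (≤-reflexive (cong suc l))
                           (All.lookup (x∈xs ∷ y∈xs ∷ z∈xs ∷ [])))

record EdgeColouring (P Q : List Color) (allowed : Color → Set) : Set where
  constructor colouring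
  field
    {p q}     : Color
    p∈P       : p ∈ P
    q∈Q       : q ∈ Q
    p≢q       : p ≢ q
    p-allowed : allowed p
    q-allowed : allowed q

map-allowed : {R R′ : Color → Set} → (∀ {t} → R t → R′ t) →
              EdgeColouring P Q R → EdgeColouring P Q R′
map-allowed f (colouring p∈P q∈Q p≢q p-ok q-ok) = colouring p∈P q∈Q p≢q (f p-ok) (f q-ok)

Pinned : List Color → List Color → Color → Color → Set
Pinned P Q x u = EdgeColouring P Q (_∈ x ∷ u ∷ [])

pinˡ : x ∈ P → u ∈ Q → x ≢ u → Pinned P Q x u
pinˡ x∈P u∈Q x≢u = colouring x∈P u∈Q x≢u (here refl) (there (here refl))

pinʳ : u ∈ P → x ∈ Q → u ≢ x → Pinned P Q x u
pinʳ u∈P x∈Q u≢x = colouring u∈P x∈Q u≢x (there (here refl)) (here refl)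

pinned-≢ : Pinned P Q x u → x ≢ u
pinned-≢ {x = x} (colouring _ _ p≢q p∈xx q∈xx) refl = p≢q (trans (sole p∈xx) (sym (sole q∈xx)))
  where
  sole : t ∈ x ∷ x ∷ [] → t ≡ x
  sole (here t≡x)         = t≡x
  sole (there (here t≡x)) = t≡x

record Pins (P Q : List Color) (x : Color) : Set where
  constructor pins
  field
    {u₁ u₂} : Color
    u₁≢u₂   : u₁ ≢ u₂
    pinned₁ : Pinned P Q x u₁
    pinned₂ : Pinned P Q x u₂

  partners : List Color
  partners = u₁ ∷ u₂ ∷ []

  x∷partners-unique : Unique (x ∷ partners)
  x∷partners-unique = (pinned-≢ pinned₁ ∷ pinned-≢ pinned₂ ∷ []) ∷ (u₁≢u₂ ∷ []) ∷ [] ∷ []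

  pinned : u ∈ partners → Pinned P Q x u
  pinned (here refl)         = pinned₁
  pinned (there (here refl)) = pinned₂

open Pins using (partners; x∷partners-unique; pinned; pinned₁)

pinsˡ : x ∈ P → x ∉ Q → Unique Q → length Q ≡ 2 → Pins P Q x
pinsˡ x∈P x∉Q uQ lQ with fresh uQ lQ []
... | u₁ , u₁∈Q , [] with fresh uQ lQ (u₁ ∷ [])
...   | u₂ , u₂∈Q , u₂≢u₁ ∷ [] =
  pins (≢-sym u₂≢u₁) (pinˡ x∈P u₁∈Q (∉⇒≢ x∉Q u₁∈Q)) (pinˡ x∈P u₂∈Q (∉⇒≢ x∉Q u₂∈Q))

pinsʳ : x ∈ Q → x ∉ P → Unique P → length P ≡ 2 → Pins P Q x
pinsʳ x∈Q x∉P uP lP with fresh uP lP []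
... | u₁ , u₁∈P , [] with fresh uP lP (u₁ ∷ [])
...   | u₂ , u₂∈P , u₂≢u₁ ∷ [] =
  pins (≢-sym u₂≢u₁) (pinʳ u₁∈P x∈Q (≢-sym (∉⇒≢ x∉P u₁∈P)))
                     (pinʳ u₂∈P x∈Q (≢-sym (∉⇒≢ x∉P u₂∈P)))

record GoodEdge (P Q : List Color) : Set where
  field
    avoid-one : ∀ s → EdgeColouring P Q (Avoiding (s ∷ []))
    pin       : ∀ {x} → x ∈ P ++ Q → Pins P Q x

  avoid-with-outside : ∀ b {c} → c ∉ P ++ Q → EdgeColouring P Q (Avoiding (b ∷ c ∷ []))
  avoid-with-outside b c∉ with avoid-one b
  ... | colouring p∈P q∈Q p≢q (p≢b ∷ []) (q≢b ∷ []) =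
    colouring p∈P q∈Q p≢q (p≢b ∷ ≢-sym (∉⇒≢ (c∉ ∘ ∈-++⁺ˡ) p∈P) ∷ [])
                          (q≢b ∷ ≢-sym (∉⇒≢ (c∉ ∘ ∈-++⁺ʳ P) q∈Q) ∷ [])

good-edge₃₂ : Unique P → length P ≡ 3 → Unique Q → length Q ≡ 2 → GoodEdge P Q
good-edge₃₂ {P} {Q} uP lP uQ lQ = record { avoid-one = avoid-one ; pin = pin }
  where
  avoid-one : ∀ s → EdgeColouring P Q (Avoiding (s ∷ []))
  avoid-one s with fresh uQ lQ (s ∷ [])
  ... | q , q∈Q , q≢s ∷ [] with fresh uP lP (s ∷ q ∷ [])
  ...   | p , p∈P , p≢s ∷ p≢q ∷ [] = colouring p∈P q∈Q p≢q (p≢s ∷ []) (q≢s ∷ [])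

  pin : x ∈ P ++ Q → Pins P Q x
  pin {x} x∈P++Q with x ∈? Q
  ... | no x∉Q = pinsˡ (fromInj₁ (⊥-elim ∘ x∉Q) (∈-++⁻ P x∈P++Q)) x∉Q uQ lQ
  ... | yes x∈Q with fresh uP lP (x ∷ [])
  ...   | u₁ , u₁∈P , u₁≢x ∷ [] with fresh uP lP (x ∷ u₁ ∷ [])
  ...     | u₂ , u₂∈P , u₂≢x ∷ u₂≢u₁ ∷ [] =
    pins (≢-sym u₂≢u₁) (pinʳ u₁∈P x∈Q u₁≢x) (pinʳ u₂∈P x∈Q u₂≢x)

distinct-partners : Unique P → length P ≡ 2 → Unique Q → length Q ≡ 2 → ¬ SameSet P Q →
                    x ∈ P → x ∈ Q → ∃₂ λ p q → p ∈ P × q ∈ Q × p ≢ x × q ≢ x × p ≢ q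
distinct-partners {P} {Q} {x} uP lP uQ lQ P≉Q x∈P x∈Q with fresh uP lP (x ∷ []) | fresh uQ lQ (x ∷ [])
... | p , p∈P , p≢x ∷ [] | q , q∈Q , q≢x ∷ [] with p ≟ q
...   | no p≢q  = p , q , p∈P , q∈Q , p≢x , q≢x , p≢q
...   | yes refl = contradiction same P≉Q
  where
  P⊆xp : P ⊆ x ∷ p ∷ []
  P⊆xp = pair-⊆ uP lP x∈P p∈P (≢-sym p≢x)
  Q⊆xp : Q ⊆ x ∷ p ∷ []
  Q⊆xp = pair-⊆ uQ lQ x∈Q q∈Q (≢-sym q≢x)
  same : SameSet P Q
  same t = All.lookup (x∈Q ∷ q∈Q ∷ []) ∘ P⊆xp , All.lookup (x∈P ∷ p∈P ∷ []) ∘ Q⊆xp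

good-edge₂₂ : Unique P → length P ≡ 2 → Unique Q → length Q ≡ 2 → ¬ SameSet P Q → GoodEdge P Q
good-edge₂₂ {P} {Q} uP lP uQ lQ P≉Q = record { avoid-one = avoid-one ; pin = pin }
  where
  avoid-one : ∀ s → EdgeColouring P Q (Avoiding (s ∷ []))
  avoid-one s with s ∈? P | s ∈? Q
  ... | _ | no s∉Q with fresh uP lP (s ∷ [])
  ...   | p , p∈P , p≢s ∷ [] with fresh uQ lQ (p ∷ [])
  ...     | q , q∈Q , q≢p ∷ [] =
    colouring p∈P q∈Q (≢-sym q≢p) (p≢s ∷ []) (≢-sym (∉⇒≢ s∉Q q∈Q) ∷ [])
  avoid-one s | no s∉P | yes _ with fresh uQ lQ (s ∷ [])
  ...   | q , q∈Q , q≢s ∷ [] with fresh uP lP (q ∷ [])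
  ...     | p , p∈P , p≢q ∷ [] =
    colouring p∈P q∈Q p≢q (≢-sym (∉⇒≢ s∉P p∈P) ∷ []) (q≢s ∷ [])
  avoid-one s | yes s∈P | yes s∈Q with distinct-partners uP lP uQ lQ P≉Q s∈P s∈Q
  ...   | p , q , p∈P , q∈Q , p≢s , q≢s , p≢q = colouring p∈P q∈Q p≢q (p≢s ∷ []) (q≢s ∷ [])

  pin : x ∈ P ++ Q → Pins P Q x
  pin {x} x∈P++Q with x ∈? P | x ∈? Q
  ... | yes x∈P | no x∉Q = pinsˡ x∈P x∉Q uQ lQ
  ... | no x∉P | yes x∈Q = pinsʳ x∈Q x∉P uP lP
  ... | no x∉P | no x∉Q = ⊥-elim ([ x∉P , x∉Q ] (∈-++⁻ P x∈P++Q))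
  ... | yes x∈P | yes x∈Q with distinct-partners uP lP uQ lQ P≉Q x∈P x∈Q
  ...   | p , q , p∈P , q∈Q , p≢x , q≢x , p≢q =
    pins (≢-sym p≢q) (pinˡ x∈P q∈Q (≢-sym q≢x)) (pinʳ p∈P x∈Q p≢x)

record JoinColouring (B C P Q P′ Q′ : List Color) : Set where
  constructor join
  field
    {b c} : Color
    b∈B   : b ∈ B
    c∈C   : c ∈ C
    b≢c   : b ≢ c
    left  : EdgeColouring P Q (Avoiding (b ∷ c ∷ []))
    right : EdgeColouring P′ Q′ (Avoiding (b ∷ c ∷ []))

swap-sides : JoinColouring B C P Q P′ Q′ → JoinColouring B C P′ Q′ P Q
swap-sides (join b∈B c∈C b≢c left right) = join b∈B c∈C b≢c right left

join-apart : ∀ {c} → Unique B → length B ≡ 4 → GoodEdge P Q → GoodEdge P′ Q′ →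
             c ∈ C → c ∉ P′ ++ Q′ → JoinColouring B C P Q P′ Q′
join-apart {c = c} uB lB G G′ c∈C c∉P′++Q′ with GoodEdge.avoid-one G c
... | colouring {p} {q} p∈P q∈Q p≢q (p≢c ∷ []) (q≢c ∷ []) with fresh uB lB (c ∷ p ∷ q ∷ [])
...   | b , b∈B , b≢c ∷ b≢p ∷ b≢q ∷ [] =
  join b∈B c∈C b≢c (colouring p∈P q∈Q p≢q (≢-sym b≢p ∷ p≢c ∷ []) (≢-sym b≢q ∷ q≢c ∷ []))
                   (GoodEdge.avoid-with-outside G′ b c∉P′++Q′)

-- x, u and w take up at most two colours of B.
Uncrowded : List Color → Color → Color → Color → Set
Uncrowded B x u w = u ≡ w ⊎ ∃ λ z → z ∈ x ∷ u ∷ w ∷ [] × z ∉ B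

choose-partners : Unique B → length B ≡ 4 → Pins P Q x → Pins P′ Q′ x →
                  ∃₂ λ u w → Pinned P Q x u × Pinned P′ Q′ x w × Uncrowded B x u w
choose-partners uB lB π π′ with any? (_∈? partners π′) (partners π)
... | yes common with find common
...   | u , u∈U , u∈W = u , u , pinned π u∈U , pinned π′ u∈W , inj₁ refl
choose-partners uB lB π π′ | no apart
  with ∉-witness (Unique-∷-++⁺ (x∷partners-unique π) (x∷partners-unique π′)
                                (λ (v∈U , v∈W) → apart (lose v∈U v∈W)))
                 (≤-reflexive (cong suc lB))
... | z , here refl , z∉B = _ , _ , pinned₁ π , pinned₁ π′ , inj₂ (z , here refl , z∉B)
... | z , there z∈U++W , z∉B with ∈-++⁻ (partners π) z∈U++W
...   | inj₁ z∈U = z , _ , pinned π z∈U , pinned₁ π′ , inj₂ (z , there (here refl) , z∉B)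
...   | inj₂ z∈W = _ , z , pinned₁ π , pinned π′ z∈W , inj₂ (z , there (there (here refl)) , z∉B)

centre-avoiding : Unique B → length B ≡ 4 → Unique C → length C ≡ 4 → Uncrowded B x u w →
                  ∃₂ λ b c → b ∈ B × c ∈ C × b ≢ c ×
                             Avoiding (x ∷ u ∷ w ∷ []) b × Avoiding (x ∷ u ∷ w ∷ []) c
centre-avoiding {x = x} {u} uB lB uC lC (inj₁ refl) with fresh uC lC (x ∷ u ∷ u ∷ [])
... | c , c∈C , c-ok with fresh uB lB (c ∷ x ∷ u ∷ [])
...   | b , b∈B , b≢c ∷ b≢x ∷ b≢u ∷ [] =
  b , c , b∈B , c∈C , b≢c , (b≢x ∷ b≢u ∷ b≢u ∷ []) , c-ok
centre-avoiding {B} {x = x} {u} {w} uB lB uC lC (inj₂ (z , z∈m , z∉B))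
  with fresh uC lC (x ∷ u ∷ w ∷ [])
... | c , c∈C , c-ok with ⊆-or-∉ B (c ∷ x ∷ u ∷ w ∷ [])
...   | inj₂ (b , b∈B , b∉) with ¬Any⇒All¬ (c ∷ x ∷ u ∷ w ∷ []) b∉
...     | b≢c ∷ b-ok = b , c , b∈B , c∈C , b≢c , b-ok , c-ok
centre-avoiding {B} {x = x} {u} {w} uB lB uC lC (inj₂ (z , z∈m , z∉B)) | c , c∈C , c-ok | inj₁ B⊆ =
  ⊥-elim (Unique-length<⇒⊈ (¬Any⇒All¬ B z∉B ∷ uB) (s≤s (≤-reflexive (sym lB))) z∷B⊆)
  where
  z∷B⊆ : z ∷ B ⊆ c ∷ x ∷ u ∷ w ∷ []
  z∷B⊆ (here refl)   = there z∈m
  z∷B⊆ (there t∈B) = B⊆ t∈B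

avoiding-swap : Avoiding m s → Avoiding m t → y ∈ m → Avoiding (s ∷ t ∷ []) y
avoiding-swap s-ok t-ok y∈m = ≢-sym (All.lookup s-ok y∈m) ∷ ≢-sym (All.lookup t-ok y∈m) ∷ []

join-shared : Unique B → length B ≡ 4 → Unique C → length C ≡ 4 →
              GoodEdge P Q → GoodEdge P′ Q′ → x ∈ P ++ Q → x ∈ P′ ++ Q′ → JoinColouring B C P Q P′ Q′
join-shared {x = x} uB lB uC lC G G′ x∈ x∈′
  with choose-partners uB lB (GoodEdge.pin G x∈) (GoodEdge.pin G′ x∈′)
... | u , w , πu , πw , room with centre-avoiding uB lB uC lC room
...   | b , c , b∈B , c∈C , b≢c , b-ok , c-ok =
  join b∈B c∈C b≢c (map-allowed (λ t∈xu → avoiding-swap b-ok c-ok (∈-++⁺ˡ t∈xu)) πu)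
                   (map-allowed (λ t∈xw → avoiding-swap b-ok c-ok (xw⊆xuw t∈xw)) πw)
  where
  xw⊆xuw : t ∈ x ∷ w ∷ [] → t ∈ x ∷ u ∷ w ∷ []
  xw⊆xuw (here e)    = here e
  xw⊆xuw (there t∈w) = there (there t∈w)

join-colouring : Unique B → length B ≡ 4 → Unique C → length C ≡ 4 →
                 GoodEdge P Q → GoodEdge P′ Q′ → JoinColouring B C P Q P′ Q′
join-colouring {P = P} {Q} {P′} {Q′} uB lB uC lC G G′ with any? (_∈? P′ ++ Q′) (P ++ Q)
... | yes shared with find shared
...   | x , x∈ , x∈′ = join-shared uB lB uC lC G G′ x∈ x∈′
join-colouring {P = P} {Q} {P′} {Q′} uB lB uC lC G G′ | no apart with fresh uC lC []
... | c , c∈C , [] with c ∈? P′ ++ Q′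
...   | no c∉′  = join-apart uB lB G G′ c∈C c∉′
...   | yes c∈′ = swap-sides (join-apart uB lB G′ G c∈C (λ c∈ → apart (lose c∈ c∈′)))

-- level v is the distance in J₂ from v to the edge v₁v₅.
level : V → ℕ
level 0F = 0
level 4F = 0
level 1F = 1
level 2F = 2
level 3F = 3
level 5F = 3

level-edge : ∀ {u v} → E u v → ∣ level u - level v ∣ ≤ 1
level-edge e12 = ≤-refl
level-edge e23 = ≤-refl
level-edge e34 = ≤-refl
level-edge e15 = z≤n
level-edge e25 = ≤-refl
level-edge e36 = ≤-refl
level-edge e46 = z≤n

level-adj : ∀ {u v} → Adj u v → ∣ level u - level v ∣ ≤ 1
level-adj (inj₁ e) = level-edge e
level-adj {u} {v} (inj₂ e) = subst (_≤ 1) (∣-∣-comm (level v) (level u)) (level-edge e)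

level-adj² : ∀ {u v} → Adj² u v → ∣ level u - level v ∣ ≤ 2
level-adj² (_ , inj₁ uv) = ≤-trans (level-adj uv) (s≤s z≤n)
level-adj² {u} {v} (_ , inj₂ (w , uw , wv)) =
  ≤-trans (∣-∣-triangle (level u) (level w) (level v)) (+-mono-≤ (level-adj uw) (level-adj wv))

far-apart : ∀ {u v} → ∣ level u - level v ∣ ≡ 3 → ¬ Adj² u v
far-apart d≡3 uv = <⇒≱ (≤-reflexive (sym d≡3)) (level-adj² uv)

square-colouring : (𝓛 : ListAssignment) →
                   JoinColouring (L 𝓛 1F) (L 𝓛 2F) (L 𝓛 0F) (L 𝓛 4F) (L 𝓛 3F) (L 𝓛 5F) →
                   Square-L-colorable 𝓛
square-colouring 𝓛 (join {b} {c} b∈B c∈C b≢c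
                      (colouring {p₁} {q₁} p₁∈ q₁∈ p₁≢q₁ (p₁≢b ∷ p₁≢c ∷ []) (q₁≢b ∷ q₁≢c ∷ []))
                      (colouring {p₂} {q₂} p₂∈ q₂∈ p₂≢q₂ (p₂≢b ∷ p₂≢c ∷ []) (q₂≢b ∷ q₂≢c ∷ []))) =
  f , f∈L , proper
  where
  f : V → Color
  f 0F = p₁
  f 1F = b
  f 2F = c
  f 3F = p₂
  f 4F = q₁
  f 5F = q₂

  f∈L : ∀ v → f v ∈ L 𝓛 v
  f∈L 0F = p₁∈
  f∈L 1F = b∈B
  f∈L 2F = c∈C
  f∈L 3F = p₂∈
  f∈L 4F = q₁∈
  f∈L 5F = q₂∈

  proper : ∀ u v → Adj² u v → f u ≢ f v
  proper 0F 0F (u≢v , _) = contradiction refl u≢v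
  proper 0F 1F _ = p₁≢b
  proper 0F 2F _ = p₁≢c
  proper 0F 3F uv = contradiction uv (far-apart refl)
  proper 0F 4F _ = p₁≢q₁
  proper 0F 5F uv = contradiction uv (far-apart refl)
  proper 1F 0F _ = ≢-sym p₁≢b
  proper 1F 1F (u≢v , _) = contradiction refl u≢v
  proper 1F 2F _ = b≢c
  proper 1F 3F _ = ≢-sym p₂≢b
  proper 1F 4F _ = ≢-sym q₁≢b
  proper 1F 5F _ = ≢-sym q₂≢b
  proper 2F 0F _ = ≢-sym p₁≢c
  proper 2F 1F _ = ≢-sym b≢c
  proper 2F 2F (u≢v , _) = contradiction refl u≢v
  proper 2F 3F _ = ≢-sym p₂≢c
  proper 2F 4F _ = ≢-sym q₁≢c
  proper 2F 5F _ = ≢-sym q₂≢c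
  proper 3F 0F uv = contradiction uv (far-apart refl)
  proper 3F 1F _ = p₂≢b
  proper 3F 2F _ = p₂≢c
  proper 3F 3F (u≢v , _) = contradiction refl u≢v
  proper 3F 4F uv = contradiction uv (far-apart refl)
  proper 3F 5F _ = p₂≢q₂
  proper 4F 0F _ = ≢-sym p₁≢q₁
  proper 4F 1F _ = q₁≢b
  proper 4F 2F _ = q₁≢c
  proper 4F 3F uv = contradiction uv (far-apart refl)
  proper 4F 4F (u≢v , _) = contradiction refl u≢v
  proper 4F 5F uv = contradiction uv (far-apart refl)
  proper 5F 0F uv = contradiction uv (far-apart refl)
  proper 5F 1F _ = q₂≢b
  proper 5F 2F _ = q₂≢c
  proper 5F 3F _ = ≢-sym p₂≢q₂
  proper 5F 4F uv = contradiction uv (far-apart refl)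
  proper 5F 5F (u≢v , _) = contradiction refl u≢v

lemma2p3 : (𝓛 : ListAssignment) →
    ( (∣ 𝓛 ∣at 0F ≡ 2) × (∣ 𝓛 ∣at 1F ≡ 4) × (∣ 𝓛 ∣at 2F ≡ 4) × (∣ 𝓛 ∣at 3F ≡ 3)
      × (∣ 𝓛 ∣at 4F ≡ 2) × (∣ 𝓛 ∣at 5F ≡ 2) × ¬ SameSet (L 𝓛 0F) (L 𝓛 4F) )
    ⊎
    ( (∣ 𝓛 ∣at 0F ≡ 3) × (∣ 𝓛 ∣at 1F ≡ 4) × (∣ 𝓛 ∣at 2F ≡ 4) × (∣ 𝓛 ∣at 3F ≡ 3)
      × (∣ 𝓛 ∣at 4F ≡ 2) × (∣ 𝓛 ∣at 5F ≡ 2) ) →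
    Square-L-colorable 𝓛
lemma2p3 𝓛 (inj₁ (l₁ , l₂ , l₃ , l₄ , l₅ , l₆ , L₁≉L₅)) =
  square-colouring 𝓛 (join-colouring (unique 𝓛 1F) l₂ (unique 𝓛 2F) l₃
    (good-edge₂₂ (unique 𝓛 0F) l₁ (unique 𝓛 4F) l₅ L₁≉L₅)
    (good-edge₃₂ (unique 𝓛 3F) l₄ (unique 𝓛 5F) l₆))
lemma2p3 𝓛 (inj₂ (l₁ , l₂ , l₃ , l₄ , l₅ , l₆)) =
  square-colouring 𝓛 (join-colouring (unique 𝓛 1F) l₂ (unique 𝓛 2F) l₃
    (good-edge₃₂ (unique 𝓛 0F) l₁ (unique 𝓛 4F) l₅)
    (good-edge₃₂ (unique 𝓛 3F) l₄ (unique 𝓛 5F) l₆))
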